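{- Let $p$ be a prime, $q$ a power of $p$, $F$ a field of characteristic $p$ containing $\mathbb{F}_q$, and $L\in F[x]$ a $q$-polynomial of $q$-degree $n$ with $q^n$ distinct roots in a splitting field $E$ over $F$; let $V\subseteq E$ be its $n$-dimensional $\mathbb{F}_q$-space of roots. Let $r\ge 1$. Let $v_1,\dots,v_n$ and $w_1,\dots,w_n$ be two ordered $\mathbb{F}_q$-bases of $V$, and let $\epsilon_r,\epsilon_r' : H_{n,r}(\mathbb{F}_q)\to E$ be given by $\epsilon_r P = P(v_1,\dots,v_n)$ and $\epsilon_r' P = P(w_1,\dots,w_n)$. Then the $\mathbb{F}_q$-subspaces of $E$ spanned by the images of $\epsilon_r$ and $\epsilon_r'$ are identical.
   Context: A $q$-polynomial is a polynomial $\sum_{i=0}^n a_i x^{q^i}$ with $a_n\ne0$ ($n$ its $q$-degree). $H_{n,r}(\mathbb{F}_q)$ denotes the $\mathbb{F}_q$-space of homogeneous polynomials of degree $r$ in indeterminates $x_1,\dots,x_n$ with coefficients in $\mathbb{F}_q$, together with $0$. -}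

module Defs where

open import Level using (Level; _⊔_) renaming (suc to lsuc)
open import Algebra.Bundles using (CommutativeRing)
open import Data.Nat as ℕ using (ℕ; zero; suc)
open import Data.Fin using (Fin; zero; suc)
open import Data.List using (List; []; _∷_)
open import Data.List.Relation.Unary.All using (All)
open import Data.Product using (Σ; ∃; _×_; _,_; proj₁; proj₂)
open import Relation.Nullary using (¬_)
open import Relation.Binary.PropositionalEquality using (_≡_)

record Field (c ℓ : Level) : Set (lsuc (c ⊔ ℓ)) where
  field
    commutativeRing : CommutativeRing c ℓ
  open CommutativeRing commutativeRing public
  field
    1≉0     : ¬ (1# ≈ 0#)
    inverse : ∀ x → ¬ (x ≈ 0#) → ∃ λ y → x * y ≈ 1#

sumℕ : ∀ {n} → (Fin n → ℕ) → ℕ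
sumℕ {zero}  f = 0
sumℕ {suc n} f = f zero ℕ.+ sumℕ (λ i → f (suc i))

module _ {c ℓ : Level} (E : Field c ℓ) where
  open Field E using (Carrier; _≈_; _+_; _*_; -_; 0#; 1#)

  pow : Carrier → ℕ → Carrier
  pow x zero    = 1#
  pow x (suc k) = x * pow x k

  natE : ℕ → Carrier
  natE zero    = 0#
  natE (suc k) = 1# + natE k

  sumFin : ∀ {n} → (Fin n → Carrier) → Carrier
  sumFin {zero}  f = 0#
  sumFin {suc n} f = f zero + sumFin (λ i → f (suc i))

  prodFin : ∀ {n} → (Fin n → Carrier) → Carrier
  prodFin {zero}  f = 1#
  prodFin {suc n} f = f zero * prodFin (λ i → f (suc i))

  -- characteristic p (p prime is assumed separately)
  HasCharacteristic : ℕ → Set ℓ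
  HasCharacteristic p = natE p ≈ 0#

  record IsSubfield (S : Carrier → Set ℓ) : Set (c ⊔ ℓ) where
    field
      resp  : ∀ {x y} → x ≈ y → S x → S y
      has0  : S 0#
      has1  : S 1#
      +-cl  : ∀ {x y} → S x → S y → S (x + y)
      neg-cl : ∀ {x} → S x → S (- x)
      *-cl  : ∀ {x y} → S x → S y → S (x * y)
      inv-cl : ∀ {x y} → S x → ¬ (x ≈ 0#) → x * y ≈ 1# → S y

  HasCard : (Carrier → Set ℓ) → ℕ → Set (c ⊔ ℓ)
  HasCard S m = Σ (Fin m → Carrier) λ f →
      (∀ i → S (f i))
    × (∀ i j → f i ≈ f j → i ≡ j)
    × (∀ x → S x → ∃ λ i → x ≈ f i)

  qPolyEval : (q n : ℕ) → (Fin (suc n) → Carrier) → Carrier → Carrier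
  qPolyEval q n a x = sumFin (λ i → a i * pow x (q ℕ.^ Data.Fin.toℕ i))

  Root : (q n : ℕ) → (Fin (suc n) → Carrier) → Carrier → Set ℓ
  Root q n a x = qPolyEval q n a x ≈ 0#

  HasDistinctRoots : (Carrier → Set ℓ) → ℕ → Set (c ⊔ ℓ)
  HasDistinctRoots R m = Σ (Fin m → Carrier) λ f →
    (∀ i → R (f i)) × (∀ i j → f i ≈ f j → i ≡ j)

  IsSplittingField : (F R : Carrier → Set ℓ) → Set (lsuc ℓ ⊔ c)
  IsSplittingField F R = (S : Carrier → Set ℓ) → IsSubfield S →
    (∀ x → F x → S x) → (∀ x → R x → S x) → ∀ x → S x

  linComb : ∀ {n} → (Fin n → Carrier) → (Fin n → Carrier) → Carrier
  linComb cs v = sumFin (λ i → cs i * v i)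

  IsBasis : (K V : Carrier → Set ℓ) → (n : ℕ) → (Fin n → Carrier) → Set (c ⊔ ℓ)
  IsBasis K V n v =
      (∀ i → V (v i))
    × (∀ (cs : Fin n → Carrier) → (∀ i → K (cs i)) → linComb cs v ≈ 0# → ∀ i → cs i ≈ 0#)
    × (∀ x → V x → Σ (Fin n → Carrier) λ cs → (∀ i → K (cs i)) × x ≈ linComb cs v)

  -- a monomial term c · x^e, e an exponent vector
  Term : ℕ → Set c
  Term n = Carrier × (Fin n → ℕ)

  -- homogeneous polynomials of degree r in x_1..x_n with coefficients in K (together with 0 = [])
  record HomPoly (K : Carrier → Set ℓ) (n r : ℕ) : Set (c ⊔ ℓ) where
    field
      terms   : List (Term n)
      coeffs  : All (λ t → K (proj₁ t)) terms
      degrees : All (λ t → sumℕ (proj₂ t) ≡ r) terms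

  evalTerms : ∀ {n} → List (Term n) → (Fin n → Carrier) → Carrier
  evalTerms []             v = 0#
  evalTerms ((a , e) ∷ ts) v = a * prodFin (λ i → pow (v i) (e i)) + evalTerms ts v

  evalHom : ∀ {K n r} → HomPoly K n r → (Fin n → Carrier) → Carrier
  evalHom P v = evalTerms (HomPoly.terms P) v

  sumScaled : ∀ {K n r} → List (Carrier × HomPoly K n r) → (Fin n → Carrier) → Carrier
  sumScaled []             v = 0#
  sumScaled ((a , P) ∷ ps) v = a * evalHom P v + sumScaled ps v

  InSpanImage : (K : Carrier → Set ℓ) (n r : ℕ) → (Fin n → Carrier) → Carrier → Set (c ⊔ ℓ)
  InSpanImage K n r v x = Σ (List (Carrier × HomPoly K n r)) λ ps →
    All (λ t → K (proj₁ t)) ps × x ≈ sumScaled ps v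

-- Each v_j is an F_q-combination of the w_i, so a degree-r monomial in the v's expands, one factor
-- at a time, into an F_q-combination of degree-r monomials in the w's. Hence the span of the image
-- of ε_r is contained in that of ε_r', and the converse holds by symmetry.
module Submission where

open import Defs
open import Data.Nat using (ℕ; suc; _^_; _≤_)
open import Data.Nat.Primality using (Prime)
open import Data.Fin using (Fin; fromℕ)
open import Data.Product using (_×_)
open import Relation.Nullary using (¬_)
open import Relation.Binary.PropositionalEquality using (_≡_)

open import Level using (_⊔_)
import Data.Nat as ℕ
open import Data.Nat using (zero)
open import Data.Nat.Properties using (+-suc; suc-injective; m+n≡0⇒m≡0; m+n≡0⇒n≡0)
open import Data.Fin using (zero; suc)
open import Data.Vec.Functional using (updateAt; tail) renaming (_∷_ to _∷ᵛ_)
open import Data.List using (List; []; _∷_)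
open import Data.List.Relation.Unary.All using (All; []; _∷_)
open import Data.Product using (Σ; ∃₂; _,_; proj₁; proj₂)
import Relation.Binary.PropositionalEquality as ≡
import Relation.Binary.Reasoning.Setoid as SetoidReasoning

sumℕ-updateAt-suc : ∀ {n} (e : Fin n → ℕ) j → sumℕ (updateAt e j suc) ≡ suc (sumℕ e)
sumℕ-updateAt-suc e zero    = ≡.refl
sumℕ-updateAt-suc e (suc j) =
  ≡.trans (≡.cong (e zero ℕ.+_) (sumℕ-updateAt-suc (tail e) j)) (+-suc (e zero) _)

sumℕ≡suc⇒updateAt-suc : ∀ {n} k (e : Fin n → ℕ) → sumℕ e ≡ suc k →
  ∃₂ λ (e′ : Fin n → ℕ) (j : Fin n) → (∀ i → e i ≡ updateAt e′ j suc i) × sumℕ e′ ≡ k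
sumℕ≡suc⇒updateAt-suc {zero}  k e ()
sumℕ≡suc⇒updateAt-suc {suc n} k e sum≡ with e zero in e₀≡
... | suc m = m ∷ᵛ tail e , zero , (λ { zero → e₀≡ ; (suc i) → ≡.refl }) , suc-injective sum≡
... | zero with sumℕ≡suc⇒updateAt-suc k (tail e) sum≡
...   | e′ , j , e≗ , sum′≡ = 0 ∷ᵛ e′ , suc j , (λ { zero → e₀≡ ; (suc i) → e≗ i }) , sum′≡

sumℕ≡0⇒≡0 : ∀ {n} (e : Fin n → ℕ) → sumℕ e ≡ 0 → ∀ i → e i ≡ 0
sumℕ≡0⇒≡0 e sum≡ zero    = m+n≡0⇒m≡0 (e zero) sum≡
sumℕ≡0⇒≡0 e sum≡ (suc i) = sumℕ≡0⇒≡0 (tail e) (m+n≡0⇒n≡0 (e zero) sum≡) i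

module _ {c ℓ} (E : Field c ℓ) where
  open Field E hiding (zero)
  open SetoidReasoning setoid
  open import Algebra.Properties.CommutativeSemigroup *-commutativeSemigroup
    using (x∙yz≈y∙xz; xy∙z≈yz∙x)

  monomial : ∀ {n} → (Fin n → Carrier) → (Fin n → ℕ) → Carrier
  monomial v e = prodFin E (λ i → pow E (v i) (e i))

  monomial-cong : ∀ {n} (v : Fin n → Carrier) {e e′ : Fin n → ℕ} → (∀ i → e i ≡ e′ i) →
    monomial v e ≈ monomial v e′
  monomial-cong {zero}  v e≗e′ = refl
  monomial-cong {suc n} v e≗e′ =
    *-cong (reflexive (≡.cong (pow E (v zero)) (e≗e′ zero)))
           (monomial-cong (tail v) (λ i → e≗e′ (suc i)))

  monomial-zero : ∀ {n} (v : Fin n → Carrier) (e : Fin n → ℕ) → (∀ i → e i ≡ 0) → monomial v e ≈ 1#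
  monomial-zero {zero}  v e e≗0 = refl
  monomial-zero {suc n} v e e≗0 = begin
    pow E (v zero) (e zero) * monomial (tail v) (tail e)
      ≈⟨ *-cong (reflexive (≡.cong (pow E (v zero)) (e≗0 zero)))
                (monomial-zero (tail v) (tail e) (λ i → e≗0 (suc i))) ⟩
    1# * 1#  ≈⟨ *-identityˡ 1# ⟩
    1#       ∎

  monomial-updateAt-suc : ∀ {n} (v : Fin n → Carrier) (e : Fin n → ℕ) j →
    monomial v (updateAt e j suc) ≈ monomial v e * v j
  monomial-updateAt-suc {suc n} v e zero = xy∙z≈yz∙x (v zero) _ _
  monomial-updateAt-suc {suc n} v e (suc j) = begin
    x * monomial (tail v) (updateAt (tail e) j suc)
      ≈⟨ *-cong refl (monomial-updateAt-suc (tail v) (tail e) j) ⟩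
    x * (monomial (tail v) (tail e) * v (suc j))  ≈⟨ *-assoc _ _ _ ⟨
    monomial v e * v (suc j)                      ∎
    where x = pow E (v zero) (e zero)

  module _ (K : Carrier → Set ℓ) (K-subfield : IsSubfield E K) where
    open IsSubfield K-subfield using (has1; *-cl)

    record IsSubspace {s} (S : Carrier → Set s) : Set (c ⊔ ℓ ⊔ s) where
      field
        resp   : ∀ {x y} → x ≈ y → S x → S y
        0∈     : S 0#
        +-cl   : ∀ {x y} → S x → S y → S (x + y)
        scale  : ∀ {a x} → K a → S x → S (a * x)
    open IsSubspace

    InSpan : ∀ {m} → (Fin m → Carrier) → Carrier → Set (c ⊔ ℓ)
    InSpan {m} w x = Σ (Fin m → Carrier) λ cs → (∀ i → K (cs i)) × x ≈ linComb E cs w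

    linComb∈ : ∀ {s} {S : Carrier → Set s} → IsSubspace S → ∀ {m} (cs g : Fin m → Carrier) →
      (∀ i → K (cs i)) → (∀ i → S (g i)) → S (linComb E cs g)
    linComb∈ S {zero}  cs g cs∈K g∈S = 0∈ S
    linComb∈ S {suc m} cs g cs∈K g∈S =
      +-cl S (scale S (cs∈K zero) (g∈S zero))
             (linComb∈ S (tail cs) (tail g) (λ i → cs∈K (suc i)) (λ i → g∈S (suc i)))

    *ˡ-preimage : ∀ {s} {S : Carrier → Set s} → IsSubspace S → ∀ y → IsSubspace (λ x → S (y * x))
    *ˡ-preimage S y = record
      { resp  = λ x≈x′ → resp S (*-cong refl x≈x′)
      ; 0∈    = resp S (sym (zeroʳ y)) (0∈ S)
      ; +-cl  = λ s t → resp S (sym (distribˡ y _ _)) (+-cl S s t)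
      ; scale = λ a∈K s → resp S (x∙yz≈y∙xz _ y _) (scale S a∈K s)
      }

    *ʳ-preimage : ∀ {s} {S : Carrier → Set s} → IsSubspace S → ∀ y → IsSubspace (λ x → S (x * y))
    *ʳ-preimage S y = record
      { resp  = λ x≈x′ → resp S (*-cong x≈x′ refl)
      ; 0∈    = resp S (sym (zeroˡ y)) (0∈ S)
      ; +-cl  = λ s t → resp S (sym (distribʳ y _ _)) (+-cl S s t)
      ; scale = λ a∈K s → resp S (sym (*-assoc _ _ _)) (scale S a∈K s)
      }

    module _ {n : ℕ} where

      InSpanImage-isSubspace : ∀ r v → IsSubspace (InSpanImage E K n r v)
      InSpanImage-isSubspace r v = record
        { resp  = λ { x≈y (ps , ps∈K , x≈) → ps , ps∈K , trans (sym x≈y) x≈ }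
        ; 0∈    = [] , [] , refl
        ; +-cl  = λ { (ps , ps∈K , x≈) (qs , qs∈K , y≈) → ++-span ps ps∈K x≈ qs qs∈K y≈ }
        ; scale = λ { a∈K (ps , ps∈K , x≈) → scale-span a∈K ps ps∈K x≈ }
        }
        where
        Entry = Carrier × HomPoly E K n r
        ++-span : ∀ {x y} (ps : List Entry) → All (λ t → K (proj₁ t)) ps → x ≈ sumScaled E ps v →
                  (qs : List Entry) → All (λ t → K (proj₁ t)) qs → y ≈ sumScaled E qs v →
                  InSpanImage E K n r v (x + y)
        ++-span [] [] x≈ qs qs∈K y≈ =
          qs , qs∈K , trans (+-cong x≈ y≈) (+-identityˡ _)
        ++-span ((a , P) ∷ ps) (a∈K ∷ ps∈K) x≈ qs qs∈K y≈
          with ++-span ps ps∈K refl qs qs∈K y≈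
        ... | rs , rs∈K , rest≈ =
          (a , P) ∷ rs , a∈K ∷ rs∈K ,
          trans (+-cong x≈ refl) (trans (+-assoc _ _ _) (+-cong refl rest≈))
        scale-span : ∀ {a x} → K a → (ps : List Entry) → All (λ t → K (proj₁ t)) ps →
                     x ≈ sumScaled E ps v → InSpanImage E K n r v (a * x)
        scale-span {a} a∈K [] [] x≈ = [] , [] , trans (*-cong refl x≈) (zeroʳ a)
        scale-span {a} a∈K ((b , P) ∷ ps) (b∈K ∷ ps∈K) x≈
          with scale-span a∈K ps ps∈K refl
        ... | rs , rs∈K , rest≈ =
          (a * b , P) ∷ rs , *-cl a∈K b∈K ∷ rs∈K ,
          trans (*-cong refl x≈) (trans (distribˡ a _ _) (+-cong (sym (*-assoc _ _ _)) rest≈))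

      monomial∈InSpanImage : ∀ {r} v (e : Fin n → ℕ) → sumℕ e ≡ r → InSpanImage E K n r v (monomial v e)
      monomial∈InSpanImage v e sum≡ =
        (1# , P) ∷ [] , has1 ∷ [] ,
        sym (trans (+-identityʳ _) (trans (*-identityˡ _) (trans (+-identityʳ _) (*-identityˡ _))))
        where
        P : HomPoly E K n _
        P = record { terms = (1# , e) ∷ [] ; coeffs = has1 ∷ [] ; degrees = sum≡ ∷ [] }

      InSpanImage-least : ∀ {s} {S : Carrier → Set s} → IsSubspace S → ∀ {r} v →
        (∀ e → sumℕ e ≡ r → S (monomial v e)) → ∀ {x} → InSpanImage E K n r v x → S x
      InSpanImage-least {S = S} S-subspace {r} v monomial∈S (ps , ps∈K , x≈) =
        resp S-subspace (sym x≈) (sumScaled∈S ps ps∈K)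
        where
        evalTerms∈S : (ts : List (Term E n)) → All (λ t → K (proj₁ t)) ts →
          All (λ t → sumℕ (proj₂ t) ≡ r) ts → S (evalTerms E ts v)
        evalTerms∈S []             []           []           = 0∈ S-subspace
        evalTerms∈S ((a , e) ∷ ts) (a∈K ∷ ts∈K) (e≡ ∷ ts≡) =
          +-cl S-subspace (scale S-subspace a∈K (monomial∈S e e≡)) (evalTerms∈S ts ts∈K ts≡)
        sumScaled∈S : (ps : List (Carrier × HomPoly E K n r)) → All (λ t → K (proj₁ t)) ps →
          S (sumScaled E ps v)
        sumScaled∈S []             []           = 0∈ S-subspace
        sumScaled∈S ((a , P) ∷ ps) (a∈K ∷ ps∈K) =
          +-cl S-subspace
            (scale S-subspace a∈K (evalTerms∈S (HomPoly.terms P) (HomPoly.coeffs P) (HomPoly.degrees P)))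
            (sumScaled∈S ps ps∈K)

      InSpanImage-*-generator : ∀ {r} v j {y} → InSpanImage E K n r v y →
        InSpanImage E K n (suc r) v (y * v j)
      InSpanImage-*-generator {r} v j =
        InSpanImage-least (*ʳ-preimage (InSpanImage-isSubspace (suc r) v) (v j)) v λ e sum≡ →
          resp (InSpanImage-isSubspace (suc r) v) (monomial-updateAt-suc v e j)
            (monomial∈InSpanImage v (updateAt e j suc) (≡.trans (sumℕ-updateAt-suc e j) (≡.cong suc sum≡)))

      monomial∈InSpanImage-of-span : ∀ {v w} → (∀ j → InSpan w (v j)) →
        ∀ r (e : Fin n → ℕ) → sumℕ e ≡ r → InSpanImage E K n r w (monomial v e)
      monomial∈InSpanImage-of-span {v} {w} v∈span zero e sum≡ =
        resp (InSpanImage-isSubspace 0 w) (trans (monomial-zero w e e≗0) (sym (monomial-zero v e e≗0)))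
          (monomial∈InSpanImage w e sum≡)
        where e≗0 = sumℕ≡0⇒≡0 e sum≡
      monomial∈InSpanImage-of-span {v} {w} v∈span (suc r) e sum≡
        with sumℕ≡suc⇒updateAt-suc r e sum≡
      ... | e′ , j , e≗ , sum′≡ with v∈span j
      ... | cs , cs∈K , vj≈ =
        resp (InSpanImage-isSubspace (suc r) w) (sym monomial≈)
          (linComb∈ (*ˡ-preimage (InSpanImage-isSubspace (suc r) w) y) cs w cs∈K
             λ i → InSpanImage-*-generator w i y∈)
        where
        y = monomial v e′
        y∈ = monomial∈InSpanImage-of-span v∈span r e′ sum′≡
        monomial≈ : monomial v e ≈ y * linComb E cs w
        monomial≈ = begin
          monomial v e                    ≈⟨ monomial-cong v e≗ ⟩
          monomial v (updateAt e′ j suc)  ≈⟨ monomial-updateAt-suc v e′ j ⟩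
          y * v j                         ≈⟨ *-cong refl vj≈ ⟩
          y * linComb E cs w              ∎

      InSpanImage-mono : ∀ {v w} → (∀ j → InSpan w (v j)) →
        ∀ r {x} → InSpanImage E K n r v x → InSpanImage E K n r w x
      InSpanImage-mono v∈span r =
        InSpanImage-least (InSpanImage-isSubspace r _) _ (monomial∈InSpanImage-of-span v∈span r)

mainTheorem4 : ∀ {c ℓ} (E : Field c ℓ) → let open Field E in
    (p q k : ℕ) → Prime p → 1 ≤ k → q ≡ p ^ k → HasCharacteristic E p →
    (F Fq : Carrier → Set ℓ) → IsSubfield E F → IsSubfield E Fq → HasCard E Fq q →
    (∀ x → Fq x → F x) →
    (n : ℕ) (a : Fin (suc n) → Carrier) → (∀ i → F (a i)) → ¬ (a (fromℕ n) ≈ 0#) →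
    HasDistinctRoots E (Root E q n a) (q ^ n) →
    IsSplittingField E F (Root E q n a) →
    (r : ℕ) → 1 ≤ r →
    (v w : Fin n → Carrier) →
    IsBasis E Fq (Root E q n a) n v → IsBasis E Fq (Root E q n a) n w →
    ∀ x → (InSpanImage E Fq n r v x → InSpanImage E Fq n r w x)
        × (InSpanImage E Fq n r w x → InSpanImage E Fq n r v x)
mainTheorem4 E p q k _ _ _ _ F Fq _ Fq-subfield _ _ n a _ _ _ _ r _ v w
  (v∈V , _ , V⊆span-v) (w∈V , _ , V⊆span-w) x =
    InSpanImage-mono E Fq Fq-subfield (λ j → V⊆span-w (v j) (v∈V j)) r
  , InSpanImage-mono E Fq Fq-subfield (λ j → V⊆span-v (w j) (w∈V j)) r
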